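{- The logic of a class $\mathcal F$ of general frames over a finite alphabet $\mathrm{Al}$ is locally tabular if and only if $\mathcal F$ is uniformly tunable.
   Context: A general frame $F=(X,(R_\Diamond)_{\Diamond\in\mathrm{Al}},\mathcal P)$ with $\mathcal P$ a Boolean subalgebra of $\mathcal P(X)$ closed under $R_\Diamond^{ -1}[\cdot]$; its logic is the set of formulas valid (true everywhere under all valuations into $\mathcal P$); the logic of a class is the set of formulas valid in all members. A logic is locally tabular if for each $k<\omega$ there are only finitely many pairwise nonequivalent formulas in $p_0,\dots,p_{k-1}$. A partition $\mathcal U$ of $X$ is $R$-tuned if for all $U,V\in\mathcal U$: if $aRb$ for some $a\in U,b\in V$, then every $a\in U$ has some $b\in V$ with $aRb$. $\mathcal F$ is uniformly tunable if there is $f:\omega\to\omega$ such that for every $F\in\mathcal F$ and every finite partition $\mathcal V$ of $X$ with $\mathcal V\subseteq\mathcal P$ there is a refinement $\mathcal U$ of $\mathcal V$ with $|\mathcal U|\le f(|\mathcal V|)$ that is $R_\Diamond$-tuned for every $\Diamond\in\mathrm{Al}$. -}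

module Defs where

open import Data.Nat using (ℕ; _<_; _≤_)
open import Data.Fin using (Fin)
open import Data.Fin.Properties using (_≟_)
open import Data.Bool using (Bool; true; false; not; _∨_)
open import Data.Product using (Σ; ∃; _×_; _,_; proj₁)
open import Data.Empty using (⊥)
open import Data.List using (List)
open import Data.List.Relation.Unary.All using (All)
open import Data.List.Relation.Unary.Any using (Any)
open import Relation.Binary.PropositionalEquality using (_≡_)
open import Relation.Nullary.Decidable using (⌊_⌋)

data Fm (m : ℕ) : Set where
  var  : ℕ → Fm m
  ⊥'   : Fm m
  _⇒_  : Fm m → Fm m → Fm m
  ◇    : Fin m → Fm m → Fm m

infixr 5 _⇒_

module _ {m : ℕ} where
  ¬' : Fm m → Fm m
  ¬' φ = φ ⇒ ⊥'

  _∧'_ : Fm m → Fm m → Fm m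
  φ ∧' ψ = ¬' (φ ⇒ ¬' ψ)

  _⇔'_ : Fm m → Fm m → Fm m
  φ ⇔' ψ = (φ ⇒ ψ) ∧' (ψ ⇒ φ)

data InVars {m : ℕ} (k : ℕ) : Fm m → Set where
  var : ∀ {i} → i < k → InVars k (var i)
  ⊥'  : InVars k ⊥'
  _⇒_ : ∀ {φ ψ} → InVars k φ → InVars k ψ → InVars k (φ ⇒ ψ)
  ◇   : ∀ {a φ} → InVars k φ → InVars k (◇ a φ)

-- Subsets of X are represented by characteristic
-- functions X → Bool; 𝒫 is a predicate on such subsets (extensional),
-- forming a Boolean subalgebra of the powerset closed under R⁻¹[·].

record GFrame (m : ℕ) : Set₁ where
  field
    X     : Set
    R     : Fin m → X → X → Set
    𝒫     : (X → Bool) → Set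
    𝒫-ext : ∀ {A B} → 𝒫 A → (∀ x → A x ≡ B x) → 𝒫 B
    𝒫-∅   : 𝒫 (λ _ → false)
    𝒫-¬   : ∀ {A} → 𝒫 A → 𝒫 (λ x → not (A x))
    𝒫-∪   : ∀ {A B} → 𝒫 A → 𝒫 B → 𝒫 (λ x → A x ∨ B x)
    -- R⁻¹[A] = { x | ∃ y. x R y ∧ y ∈ A } belongs to 𝒫
    𝒫-pre : ∀ (a : Fin m) {A} → 𝒫 A →
            Σ (X → Bool) λ B → 𝒫 B ×
              (∀ x → (B x ≡ true → ∃ λ y → R a x y × A y ≡ true)
                   × ((∃ λ y → R a x y × A y ≡ true) → B x ≡ true))

open GFrame public

module _ {m : ℕ} (F : GFrame m) where
  Valuation : Set
  Valuation = ℕ → Σ (X F → Bool) (𝒫 F)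

  ⟦_⟧ : Fm m → Valuation → Σ (X F → Bool) (𝒫 F)
  ⟦ var i ⟧ v = v i
  ⟦ ⊥' ⟧ v = (λ _ → false) , 𝒫-∅ F
  ⟦ φ ⇒ ψ ⟧ v with ⟦ φ ⟧ v | ⟦ ψ ⟧ v
  ... | (A , pA) | (B , pB) = (λ x → not (A x) ∨ B x) , 𝒫-∪ F (𝒫-¬ F pA) pB
  ⟦ ◇ a φ ⟧ v with 𝒫-pre F a (Data.Product.proj₂ (⟦ φ ⟧ v))
  ... | (B , pB , _) = B , pB

  Valid : Fm m → Set
  Valid φ = ∀ (v : Valuation) (x : X F) → proj₁ (⟦ φ ⟧ v) x ≡ true

Class : ℕ → Set₂
Class m = GFrame m → Set₁

LogicOf : ∀ {m} → Class m → Fm m → Set₁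
LogicOf 𝓕 φ = ∀ (F : GFrame _) → 𝓕 F → Valid F φ

LocallyTabular : ∀ {m} → (Fm m → Set₁) → Set₁
LocallyTabular {m} L =
  ∀ (k : ℕ) → Σ (List (Fm m)) λ reps →
    All (InVars k) reps ×
    (∀ (φ : Fm m) → InVars k φ → Any (λ ψ → L (φ ⇔' ψ)) reps)

-- Partitions.  A partition of X into n (nonempty) blocks is given by a
-- surjective labelling c : X → Fin n; block i is c⁻¹(i).

Block : ∀ {X : Set} {n} → (X → Fin n) → Fin n → X → Bool
Block c i x = ⌊ c x ≟ i ⌋

Surjective : ∀ {X : Set} {n} → (X → Fin n) → Set
Surjective {X} c = ∀ i → ∃ λ (x : X) → c x ≡ i

Refines : ∀ {X : Set} {n n'} → (X → Fin n') → (X → Fin n) → Set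
Refines {X} d c = ∀ (x y : X) → d x ≡ d y → c x ≡ c y

Tuned : ∀ {X : Set} {n} → (X → X → Set) → (X → Fin n) → Set
Tuned {X} R d = ∀ (a a' b : X) → d a ≡ d a' → R a b →
                ∃ λ b' → d b' ≡ d b × R a' b'

UniformlyTunable : ∀ {m} → Class m → Set₁
UniformlyTunable {m} 𝓕 =
  Σ (ℕ → ℕ) λ f →
    ∀ (F : GFrame m) → 𝓕 F →
    ∀ (n : ℕ) (c : X F → Fin n) → Surjective c → (∀ i → 𝒫 F (Block c i)) →
    Σ ℕ λ n' → n' ≤ f n × Σ (X F → Fin n') λ d →
      Refines d c × (∀ (a : Fin m) → Tuned (R F a) d)

-- Local tabularity ⇒ uniform tunability: if φ₁ … φᵣ represent the formulas in n variables up to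
-- equivalence in the logic, read pᵢ as the i-th block of a partition c into n admissible blocks and
-- refine c by the truth profile of a point on φ₁ … φᵣ.  This has at most 2ʳ blocks, each defined by a
-- characteristic formula χ, and it is tuned because ◇χ is again equivalent to some φⱼ.
--
-- Uniform tunability ⇒ local tabularity: fix k and let N ≥ f n for all n ≤ 2ᵏ.  In a frame of the
-- class, the partition by truth profiles of p₀ … pₖ₋₁ has at most 2ᵏ admissible blocks, so it has a
-- tuned refinement into at most N blocks, and the map onto the quotient model on Fin N is a bounded
-- morphism.  Hence formulas in k variables with the same truth table over all models on Fin N are
-- equivalent in the logic.  There are finitely many truth tables and equality of tables is a
-- congruence, so saturating under the connectives yields finitely many representatives.
module Submission where

open import Defs
open import Data.Bool using (Bool; true; false; not; _∨_; _∧_)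
import Data.Bool.Properties as Bool
open import Data.Fin using (Fin; zero; suc; toℕ; fromℕ<; inject≤; combine; funToFin; finToFun)
open import Data.Fin.Properties
  using ( _≟_; any?; suc-injective; toℕ<n; toℕ-fromℕ<; fromℕ<-toℕ; finToFun-funToFin
        ; inject≤-injective; injective⇒≤)
open import Data.List
  using (List; _∷_; _++_; map; tabulate; allFin; applyUpTo; cartesianProductWith; length; lookup)
open import Data.List.Extrema.Nat using (max; xs≤max)
open import Data.List.Membership.Propositional.Properties
  using (∈-++⁺ˡ; ∈-++⁺ʳ; ∈-map⁺; ∈-tabulate⁺; ∈-allFin; ∈-cartesianProductWith⁺; ∈-applyUpTo⁺; ∈-lookup)
import Data.List.Relation.Unary.All as All
import Data.List.Relation.Unary.All.Properties as All
import Data.List.Relation.Unary.Any as Any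
import Data.List.Relation.Unary.Any.Properties as Any
open import Data.Nat using (ℕ; zero; suc; _+_; _^_; _≤_; _<_; s≤s)
open import Data.Nat.Properties using (_<?_; ≤-trans; ≤-refl; n<1+n; +-suc; +-identityʳ; <⇒≱)
open import Data.Product using (Σ; ∃; ∃₂; _×_; _,_; proj₁; proj₂)
open import Data.Unit using (⊤; tt)
import Data.Vec.Functional as Vec
open import Effect.Monad using (RawMonad)
open import Function using (_∘_; id)
open import Function.Bundles using (_⇔_; mk⇔; Equivalence)
open import Function.Definitions using (Injective)
open import Relation.Binary.PropositionalEquality
open import Relation.Nullary using (¬_; Dec; yes; no; contradiction)
open import Relation.Nullary.Decidable using (⌊_⌋; decidable-stable; ¬¬-excluded-middle; _×-dec_)
open import Relation.Nullary.Negation using (¬¬-Monad; ¬¬-map)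
open import Relation.Unary using (Decidable)

open Equivalence using (to; from)

⌊⌋-≡true⇔ : ∀ {A : Set} (a? : Dec A) → ⌊ a? ⌋ ≡ true ⇔ A
⌊⌋-≡true⇔ (yes a) = mk⇔ (λ _ → a) (λ _ → refl)
⌊⌋-≡true⇔ (no ¬a) = mk⇔ (λ ()) (λ a → contradiction a ¬a)

¬¬-Π-Fin : ∀ {n} {P : Fin n → Set} → (∀ i → ¬ ¬ P i) → ¬ ¬ (∀ i → P i)
¬¬-Π-Fin {zero}  _   k = k λ ()
¬¬-Π-Fin {suc n} ¬¬P k = ¬¬P zero λ p₀ → ¬¬-Π-Fin (¬¬P ∘ suc) λ ps → k λ where
  zero    → p₀
  (suc i) → ps i

bit : Bool → Fin 2
bit false = zero
bit true  = suc zero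

unbit : Fin 2 → Bool
unbit zero    = false
unbit (suc _) = true

unbit-bit : ∀ b → unbit (bit b) ≡ b
unbit-bit false = refl
unbit-bit true  = refl

funToFin-cong : ∀ {n q} {f g : Fin n → Fin q} → f ≗ g → funToFin f ≡ funToFin g
funToFin-cong {zero}  f≗g = refl
funToFin-cong {suc n} f≗g = cong₂ combine (f≗g zero) (funToFin-cong (f≗g ∘ suc))

funToFin-injective : ∀ {n q} {f g : Fin n → Fin q} → funToFin f ≡ funToFin g → f ≗ g
funToFin-injective {n} {q} {f} {g} eq i = begin
  f i                             ≡⟨ finToFun-funToFin f i ⟨
  finToFun {q} {n} (funToFin f) i ≡⟨ cong (λ c → finToFun c i) eq ⟩
  finToFun (funToFin g) i         ≡⟨ finToFun-funToFin g i ⟩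
  g i                             ∎
  where open ≡-Reasoning

⌜_⌝ : ∀ {n} → (Fin n → Bool) → Fin (2 ^ n)
⌜ f ⌝ = funToFin (bit ∘ f)

⌞_⌟ : ∀ {n} → Fin (2 ^ n) → Fin n → Bool
⌞_⌟ {n} c = unbit ∘ finToFun {2} {n} c

⌞⌜⌝⌟ : ∀ {n} (f : Fin n → Bool) → ⌞ ⌜ f ⌝ ⌟ ≗ f
⌞⌜⌝⌟ f i = trans (cong unbit (finToFun-funToFin (bit ∘ f) i)) (unbit-bit (f i))

⌜⌝-cong : ∀ {n} {f g : Fin n → Bool} → f ≗ g → ⌜ f ⌝ ≡ ⌜ g ⌝
⌜⌝-cong f≗g = funToFin-cong (cong bit ∘ f≗g)

⌜⌝-injective : ∀ {n} {f g : Fin n → Bool} → ⌜ f ⌝ ≡ ⌜ g ⌝ → f ≗ g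
⌜⌝-injective {f = f} {g} eq i = begin
  f i               ≡⟨ unbit-bit (f i) ⟨
  unbit (bit (f i)) ≡⟨ cong unbit (funToFin-injective eq i) ⟩
  unbit (bit (g i)) ≡⟨ unbit-bit (g i) ⟩
  g i               ∎
  where open ≡-Reasoning

module _ {m : ℕ} where
  ⊤' : Fm m
  ⊤' = ¬' ⊥'

  ⋀ : ∀ {n} → (Fin n → Fm m) → Fm m
  ⋀ {zero}  _  = ⊤'
  ⋀ {suc n} φs = φs zero ∧' ⋀ (φs ∘ suc)

  literal : Fm m → Bool → Fm m
  literal φ true  = φ
  literal φ false = ¬' φ

  ⋀-InVars : ∀ {k n} {φs : Fin n → Fm m} → (∀ i → InVars k (φs i)) → InVars k (⋀ φs)
  ⋀-InVars {n = zero}  _   = ⊥' ⇒ ⊥'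
  ⋀-InVars {n = suc n} inv = (inv zero ⇒ (⋀-InVars (inv ∘ suc) ⇒ ⊥')) ⇒ ⊥'

  literal-InVars : ∀ {k φ} b → InVars k φ → InVars k (literal φ b)
  literal-InVars true  inv = inv
  literal-InVars false inv = inv ⇒ ⊥'

private
  ∧'-semantics : ∀ a b → not (not a ∨ (not b ∨ false)) ∨ false ≡ a ∧ b
  ∧'-semantics true  true  = refl
  ∧'-semantics true  false = refl
  ∧'-semantics false _     = refl

  ∧-≡true⇔ : ∀ {a b} → a ∧ b ≡ true ⇔ (a ≡ true × b ≡ true)
  ∧-≡true⇔ {true}  {true}  = mk⇔ (λ _ → refl , refl) (λ _ → refl)
  ∧-≡true⇔ {true}  {false} = mk⇔ (λ ()) (λ ())
  ∧-≡true⇔ {false}         = mk⇔ (λ ()) (λ ())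

  not∨false-≡true⇔ : ∀ {a} → not a ∨ false ≡ true ⇔ a ≡ false
  not∨false-≡true⇔ {true}  = mk⇔ (λ ()) (λ ())
  not∨false-≡true⇔ {false} = mk⇔ (λ _ → refl) (λ _ → refl)

  biimplication-≡true⇔ : ∀ {a b} → (not a ∨ b) ∧ (not b ∨ a) ≡ true ⇔ a ≡ b
  biimplication-≡true⇔ {true}  {true}  = mk⇔ (λ _ → refl) (λ _ → refl)
  biimplication-≡true⇔ {true}  {false} = mk⇔ (λ ()) (λ ())
  biimplication-≡true⇔ {false} {true}  = mk⇔ (λ ()) (λ ())
  biimplication-≡true⇔ {false} {false} = mk⇔ (λ _ → refl) (λ _ → refl)

module Semantics {m : ℕ} (F : GFrame m) (v : Valuation F) where

  truth : Fm m → X F → Bool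
  truth φ = proj₁ (⟦ F ⟧ φ v)

  truth-∧' : ∀ φ ψ x → truth (φ ∧' ψ) x ≡ truth φ x ∧ truth ψ x
  truth-∧' φ ψ x = ∧'-semantics (truth φ x) (truth ψ x)

  ⇔'-true⇔≡ : ∀ {φ ψ x} → truth (φ ⇔' ψ) x ≡ true ⇔ truth φ x ≡ truth ψ x
  ⇔'-true⇔≡ {φ} {ψ} {x} rewrite truth-∧' (φ ⇒ ψ) (ψ ⇒ φ) x = biimplication-≡true⇔

  ◇-elim : ∀ {a φ x} → truth (◇ a φ) x ≡ true → ∃ λ y → R F a x y × truth φ y ≡ true
  ◇-elim {a} {φ} {x} = proj₁ (proj₂ (proj₂ (𝒫-pre F a (proj₂ (⟦ F ⟧ φ v)))) x)

  ◇-intro : ∀ {a φ x y} → R F a x y → truth φ y ≡ true → truth (◇ a φ) x ≡ true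
  ◇-intro {a} {φ} {x} {y} r t =
    proj₂ (proj₂ (proj₂ (𝒫-pre F a (proj₂ (⟦ F ⟧ φ v)))) x) (y , r , t)

  ◇-cong : ∀ a φ ψ → (∀ y → truth φ y ≡ truth ψ y) → ∀ x → truth (◇ a φ) x ≡ truth (◇ a ψ) x
  ◇-cong a φ ψ φ≗ψ x = Bool.⇔→≡ (mk⇔ (transport φ ψ φ≗ψ) (transport ψ φ (sym ∘ φ≗ψ)))
    where
    transport : ∀ φ ψ → (∀ y → truth φ y ≡ truth ψ y) →
                truth (◇ a φ) x ≡ true → truth (◇ a ψ) x ≡ true
    transport φ ψ φ≗ψ t with y , r , ty ← ◇-elim {φ = φ} t =
      ◇-intro {φ = ψ} r (trans (sym (φ≗ψ y)) ty)

  truth-literal : ∀ {φ b x} → truth (literal φ b) x ≡ true ⇔ truth φ x ≡ b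
  truth-literal {b = true}  = mk⇔ id id
  truth-literal {b = false} = not∨false-≡true⇔

  truth-⋀ : ∀ {n} {φs : Fin n → Fm m} {x} →
            truth (⋀ φs) x ≡ true ⇔ (∀ i → truth (φs i) x ≡ true)
  truth-⋀ {zero}          = mk⇔ (λ _ ()) (λ _ → refl)
  truth-⋀ {suc n} {φs} {x} rewrite truth-∧' (φs zero) (⋀ (φs ∘ suc)) x = mk⇔
    (λ t → let t₀ , t₊ = to ∧-≡true⇔ t in λ where
      zero    → t₀
      (suc i) → to truth-⋀ t₊ i)
    (λ ts → from ∧-≡true⇔ (ts zero , from truth-⋀ (ts ∘ suc)))

  profile : ∀ {n} → (Fin n → Fm m) → X F → Fin (2 ^ n)
  profile φs x = ⌜ (λ i → truth (φs i) x) ⌝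

  char : ∀ {n} → (Fin n → Fm m) → X F → Fm m
  char φs b = ⋀ λ i → literal (φs i) (truth (φs i) b)

  char-InVars : ∀ {k n} {φs : Fin n → Fm m} → (∀ i → InVars k (φs i)) →
                ∀ b → InVars k (char φs b)
  char-InVars inv b = ⋀-InVars λ i → literal-InVars _ (inv i)

  truth-char : ∀ {n} {φs : Fin n → Fm m} {b z} →
               truth (char φs b) z ≡ true ⇔ profile φs z ≡ profile φs b
  truth-char {n} {φs} = mk⇔
    (λ t → ⌜⌝-cong {n} λ i → to truth-literal (to truth-⋀ t i))
    (λ eq → from truth-⋀ λ i → from truth-literal (⌜⌝-injective {n} eq i))

  profile-tuned : ∀ {n} {φs : Fin n → Fm m} a →
    (∀ b {x y} → profile φs x ≡ profile φs y →
                 truth (◇ a (char φs b)) x ≡ truth (◇ a (char φs b)) y) →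
    Tuned (R F a) (profile φs)
  profile-tuned {φs = φs} a ◇-respects x x' b eq r =
    let ◇char-at-x  = ◇-intro {φ = char φs b} r (from (truth-char {φs = φs}) refl)
        b' , r' , t = ◇-elim {φ = char φs b} (trans (sym (◇-respects b eq)) ◇char-at-x)
    in b' , to (truth-char {φs = φs}) t , r'

  Block∈𝒫 : ∀ {n r} {φs : Fin r → Fm m} {c : X F → Fin n} → Surjective c →
            (∀ {x y} → c x ≡ c y ⇔ profile φs x ≡ profile φs y) → ∀ i → 𝒫 F (Block c i)
  Block∈𝒫 {φs = φs} {c} c-surjective c-kernel i with w , cw≡i ← c-surjective i =
    𝒫-ext F (proj₂ (⟦ F ⟧ (char φs w) v)) λ z → Bool.⇔→≡ (mk⇔
      (λ t → from (⌊⌋-≡true⇔ (c z ≟ i))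
                  (trans (from c-kernel (to (truth-char {φs = φs}) t)) cw≡i))
      (λ t → from (truth-char {φs = φs})
                  (to c-kernel (trans (to (⌊⌋-≡true⇔ (c z ≟ i)) t) (sym cw≡i)))))

valuationOf : ∀ {m k} (F : GFrame m) → (Fin k → Σ (X F → Bool) (𝒫 F)) → Valuation F
valuationOf {k = k} F V i with i <? k
... | yes i<k = V (fromℕ< i<k)
... | no _    = (λ _ → false) , 𝒫-∅ F

valuationOf-toℕ : ∀ {m k} (F : GFrame m) V (i : Fin k) → valuationOf F V (toℕ i) ≡ V i
valuationOf-toℕ {k = k} F V i with toℕ i <? k
... | yes i<k = cong V (fromℕ<-toℕ i i<k)
... | no i≮k  = contradiction (toℕ<n i) i≮k

-- Local tabularity implies uniform tunability

module FromLocalTabularity {m} {𝓕 : Class m} (tabular : LocallyTabular (LogicOf 𝓕)) (n : ℕ) where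

  representatives : List (Fm m)
  representatives = proj₁ (tabular n)

  representative : Fin (length representatives) → Fm m
  representative = lookup representatives

  representative-InVars : ∀ i → InVars n (representative i)
  representative-InVars i = All.lookup (proj₁ (proj₂ (tabular n))) (∈-lookup i)

  module _ {F : GFrame m} (F∈𝓕 : 𝓕 F) (v : Valuation F) where
    open Semantics F v

    profile-determines-truth : ∀ {x y} → profile representative x ≡ profile representative y →
                               ∀ {φ} → InVars n φ → truth φ x ≡ truth φ y
    profile-determines-truth {x} {y} eq {φ} inv = begin
      truth φ x                  ≡⟨ to (⇔'-true⇔≡ {φ} {representative i}) (equivalent x) ⟩
      truth (representative i) x ≡⟨ ⌜⌝-injective {length representatives} eq i ⟩
      truth (representative i) y ≡⟨ to (⇔'-true⇔≡ {φ} {representative i}) (equivalent y) ⟨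
      truth φ y                  ∎
      where
      open ≡-Reasoning
      represented = proj₂ (proj₂ (tabular n)) φ inv
      i = Any.index represented
      equivalent = Any.lookup-result represented F F∈𝓕 v

    representatives-tuned : ∀ a → Tuned (R F a) (profile representative)
    representatives-tuned a = profile-tuned {φs = representative} a λ b eq →
      profile-determines-truth eq (◇ (char-InVars representative-InVars b))

  module _ {F : GFrame m} (F∈𝓕 : 𝓕 F) (c : X F → Fin n) (blocks : ∀ i → 𝒫 F (Block c i)) where
    partitionValuation : Valuation F
    partitionValuation = valuationOf F λ i → Block c i , blocks i

    open Semantics F partitionValuation

    profile-refines : Refines (profile representative) c
    profile-refines x y eq = sym (to (⌊⌋-≡true⇔ (c y ≟ c x)) (begin
      Block c (c x) y             ≡⟨ var-truth y ⟨
      truth (var (toℕ (c x))) y   ≡⟨ same-truth (var (toℕ<n (c x))) ⟨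
      truth (var (toℕ (c x))) x   ≡⟨ var-truth x ⟩
      Block c (c x) x             ≡⟨ from (⌊⌋-≡true⇔ (c x ≟ c x)) refl ⟩
      true                        ∎))
      where
      open ≡-Reasoning
      same-truth = profile-determines-truth F∈𝓕 partitionValuation eq
      var-truth : ∀ z → truth (var (toℕ (c x))) z ≡ Block c (c x) z
      var-truth z = cong (λ V → proj₁ V z) (valuationOf-toℕ F (λ i → Block c i , blocks i) (c x))

    tuned-refinement : Σ ℕ λ n' → n' ≤ 2 ^ length representatives × Σ (X F → Fin n') λ d →
                       Refines d c × (∀ a → Tuned (R F a) d)
    tuned-refinement = _ , ≤-refl , profile representative , profile-refines ,
                       representatives-tuned F∈𝓕 partitionValuation

locallyTabular⇒uniformlyTunable : ∀ {m} (𝓕 : Class m) →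
                                  LocallyTabular (LogicOf 𝓕) → UniformlyTunable 𝓕
locallyTabular⇒uniformlyTunable 𝓕 tabular =
  (λ n → 2 ^ length (proj₁ (tabular n))) , λ F F∈𝓕 n c _surjective blocks →
    FromLocalTabularity.tuned-refinement tabular n F∈𝓕 c blocks

record BoundedMorphism {m} (k : ℕ) (F G : GFrame m) (v : Valuation F) (w : Valuation G)
                       (h : X F → X G) : Set where
  field
    forth : ∀ a {x y} → R F a x y → R G a (h x) (h y)
    back  : ∀ a {x u} → R G a (h x) u → ∃ λ y → R F a x y × h y ≡ u
    atoms : ∀ (i : Fin k) x → proj₁ (v (toℕ i)) x ≡ proj₁ (w (toℕ i)) (h x)

module _ {m k} {F G : GFrame m} {v : Valuation F} {w : Valuation G} {h : X F → X G}
         (hom : BoundedMorphism k F G v w h) where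
  open BoundedMorphism hom
  private
    module F = Semantics F v
    module G = Semantics G w

  bounded-morphism-preserves-truth : ∀ {φ} → InVars k φ → ∀ x → F.truth φ x ≡ G.truth φ (h x)
  bounded-morphism-preserves-truth (var {i} i<k) x =
    subst (λ j → proj₁ (v j) x ≡ proj₁ (w j) (h x)) (toℕ-fromℕ< i<k) (atoms (fromℕ< i<k) x)
  bounded-morphism-preserves-truth ⊥' x = refl
  bounded-morphism-preserves-truth (inv₁ ⇒ inv₂) x =
    cong₂ (λ a b → not a ∨ b) (bounded-morphism-preserves-truth inv₁ x)
                              (bounded-morphism-preserves-truth inv₂ x)
  bounded-morphism-preserves-truth {◇ a φ} (◇ inv) x = Bool.⇔→≡ (mk⇔ forward backward)
    where
    forward : F.truth (◇ a φ) x ≡ true → G.truth (◇ a φ) (h x) ≡ true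
    forward t with y , r , ty ← F.◇-elim {φ = φ} t =
      G.◇-intro {φ = φ} (forth a r) (trans (sym (bounded-morphism-preserves-truth inv y)) ty)
    backward : G.truth (◇ a φ) (h x) ≡ true → F.truth (◇ a φ) x ≡ true
    backward t =
      let u , r , tu = G.◇-elim {φ = φ} t
          y , r' , hy≡u = back a r
      in F.◇-intro {φ = φ} r'
           (trans (bounded-morphism-preserves-truth inv y) (trans (cong (G.truth φ) hy≡u) tu))

finiteFrame : ∀ {m N} → (Fin m → Fin N → Fin N → Bool) → GFrame m
finiteFrame {N = N} rel = record
  { X     = Fin N
  ; R     = λ a j j' → rel a j j' ≡ true
  ; 𝒫     = λ _ → ⊤
  ; 𝒫-ext = λ _ _ → tt
  ; 𝒫-∅   = tt
  ; 𝒫-¬   = λ _ → tt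
  ; 𝒫-∪   = λ _ _ → tt
  ; 𝒫-pre = λ a {A} _ →
      let successor? = λ j → any? λ j' → (rel a j j' Bool.≟ true) ×-dec (A j' Bool.≟ true)
      in (λ j → ⌊ successor? j ⌋) , tt ,
         λ j → to (⌊⌋-≡true⇔ (successor? j)) , from (⌊⌋-≡true⇔ (successor? j))
  }

finiteValuation : ∀ {m N k} (rel : Fin m → Fin N → Fin N → Bool) → (Fin N → Fin k → Bool) →
                  Valuation (finiteFrame rel)
finiteValuation rel val = valuationOf (finiteFrame rel) λ i → (λ j → val j i) , tt

finiteValuation-toℕ : ∀ {m N k} rel (val : Fin N → Fin k → Bool) i j →
                      proj₁ (finiteValuation {m} rel val (toℕ i)) j ≡ val j i
finiteValuation-toℕ rel val i j =
  cong (λ V → proj₁ V j) (valuationOf-toℕ (finiteFrame rel) (λ i → (λ j → val j i) , tt) i)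

record Enumeration {K} (P : Fin K → Set) : Set where
  field
    size      : ℕ
    enum      : Fin size → Fin K
    injective : Injective _≡_ _≡_ enum
    sound     : ∀ i → P (enum i)
    complete  : ∀ {j} → P j → ∃ λ i → enum i ≡ j

enumerate : ∀ {K} {P : Fin K → Set} → Decidable P → Enumeration P
enumerate {zero} _ = record
  { size = 0 ; enum = λ () ; injective = λ {} ; sound = λ () ; complete = λ {} }
enumerate {suc K} {P} P? with P? zero | enumerate (P? ∘ suc)
... | yes p₀ | E = record
  { size      = suc size
  ; enum      = zero Vec.∷ suc ∘ enum
  ; injective = injective′
  ; sound     = sound′
  ; complete  = complete′
  }
  where
  open Enumeration E
  injective′ : Injective _≡_ _≡_ (zero Vec.∷ suc ∘ enum)
  injective′ {zero}  {zero}  _  = refl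
  injective′ {suc i} {suc j} eq = cong suc (injective (suc-injective eq))
  sound′ : ∀ i → P ((zero Vec.∷ suc ∘ enum) i)
  sound′ zero    = p₀
  sound′ (suc i) = sound i
  complete′ : ∀ {j} → P j → ∃ λ i → (zero Vec.∷ suc ∘ enum) i ≡ j
  complete′ {zero}  _ = zero , refl
  complete′ {suc j} p = let i , eq = complete p in suc i , cong suc eq
... | no ¬p₀ | E = record
  { size      = size
  ; enum      = suc ∘ enum
  ; injective = injective ∘ suc-injective
  ; sound     = sound
  ; complete  = complete′
  }
  where
  open Enumeration E
  complete′ : ∀ {j} → P j → ∃ λ i → suc (enum i) ≡ j
  complete′ {zero}  p = contradiction p ¬p₀
  complete′ {suc j} p = let i , eq = complete p in i , cong suc eq

record ImageFactorisation {X : Set} {K} (e : X → Fin K) : Set where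
  field
    n          : ℕ
    surjection : X → Fin n
    injection  : Fin n → Fin K
    surjective : Surjective surjection
    injective  : Injective _≡_ _≡_ injection
    factorises : ∀ x → injection (surjection x) ≡ e x

  n≤K : n ≤ K
  n≤K = injective⇒≤ injective

  surjection-≡⇔ : ∀ {x y} → surjection x ≡ surjection y ⇔ e x ≡ e y
  surjection-≡⇔ {x} {y} = mk⇔
    (λ eq → trans (sym (factorises x)) (trans (cong injection eq) (factorises y)))
    (λ eq → injective (trans (factorises x) (trans eq (sym (factorises y)))))

image-factorisation : ∀ {X : Set} {K} (e : X → Fin K) → (∀ j → Dec (∃ λ x → e x ≡ j)) →
                      ImageFactorisation e
image-factorisation e image? = record
  { n          = size
  ; surjection = surjection
  ; injection  = enum
  ; surjective = λ i → let x , ex≡ = sound i in x , injective (trans (factorises x) ex≡)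
  ; injective  = injective
  ; factorises = factorises
  }
  where
  open Enumeration (enumerate image?)
  surjection = λ x → proj₁ (complete (x , refl))
  factorises = λ x → proj₂ (complete (x , refl))

module Saturation {A : Set} {Q : ℕ} (key : A → Fin Q) where

  Covers : ∀ {s} → (Fin s → A) → A → Set
  Covers S a = ∃ λ i → key a ≡ key (S i)

  covers? : ∀ {s} (S : Fin s → A) → Decidable (Covers S)
  covers? S a = any? λ i → key a ≟ key (S i)

  ∷-injective : ∀ {s} {S : Fin s → A} {a} → ¬ Covers S a → Injective _≡_ _≡_ (key ∘ S) →
                Injective _≡_ _≡_ (key ∘ (a Vec.∷ S))
  ∷-injective a∉S inj {zero}  {zero}  _  = refl
  ∷-injective a∉S inj {zero}  {suc j} eq = contradiction (j , eq) a∉S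
  ∷-injective a∉S inj {suc i} {zero}  eq = contradiction (i , sym eq) a∉S
  ∷-injective a∉S inj {suc i} {suc j} eq = cong suc (inj eq)

  saturate : (next : ∀ {s} → (Fin s → A) → List A) →
             ∃ λ s → Σ (Fin s → A) λ S → All.All (Covers S) (next S)
  saturate next = grow (suc Q) {0} (λ ()) (λ {}) (n<1+n Q)
    where
    -- S never repeats a key, so it has at most Q members and Q + 1 rounds suffice.
    grow : ∀ fuel {s} (S : Fin s → A) → Injective _≡_ _≡_ (key ∘ S) → Q < s + fuel →
           ∃ λ s → Σ (Fin s → A) λ S → All.All (Covers S) (next S)
    grow zero {s} S inj Q<s =
      contradiction (injective⇒≤ inj) (<⇒≱ (subst (Q <_) (+-identityʳ s) Q<s))
    grow (suc fuel) {s} S inj Q<s with All.all? (covers? S) (next S)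
    ... | yes saturated = s , S , saturated
    ... | no ¬saturated
      with a , a∉S ← Any.satisfied (All.¬All⇒Any¬ (covers? S) (next S) ¬saturated) =
      grow fuel (a Vec.∷ S) (∷-injective a∉S inj) (subst (Q <_) (+-suc s fuel) Q<s)

module Generation (m k : ℕ) where

  Fmₖ : Set
  Fmₖ = Σ (Fm m) (InVars k)

  varₖ : Fin k → Fmₖ
  varₖ i = var (toℕ i) , var (toℕ<n i)

  _⇒ₖ_ : Fmₖ → Fmₖ → Fmₖ
  φ ⇒ₖ ψ = proj₁ φ ⇒ proj₁ ψ , proj₂ φ ⇒ proj₂ ψ

  ◇ₖ : Fin m → Fmₖ → Fmₖ
  ◇ₖ a φ = ◇ a (proj₁ φ) , ◇ (proj₂ φ)

  oneStep : ∀ {s} → (Fin s → Fmₖ) → List Fmₖ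
  oneStep S = map varₖ (allFin k) ++ (⊥' , ⊥') ∷
              cartesianProductWith _⇒ₖ_ (tabulate S) (tabulate S) ++
              cartesianProductWith ◇ₖ (allFin m) (tabulate S)

  module _ {Q} (key : Fm m → Fin Q)
           (key-⇒ : ∀ {φ φ' ψ ψ'} → key φ ≡ key φ' → key ψ ≡ key ψ' →
                    key (φ ⇒ ψ) ≡ key (φ' ⇒ ψ'))
           (key-◇ : ∀ {a φ φ'} → key φ ≡ key φ' → key (◇ a φ) ≡ key (◇ a φ')) where
    open Saturation {Fmₖ} (key ∘ proj₁)

    saturated-covers : ∀ {s} {S : Fin s → Fmₖ} → All.All (Covers S) (oneStep S) →
                       ∀ {φ} (inv : InVars k φ) → Covers S (φ , inv)
    saturated-covers sat (var i<k)
      with j , eq ← All.lookup sat (∈-++⁺ˡ (∈-map⁺ varₖ (∈-allFin (fromℕ< i<k))))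
      = j , trans (cong (key ∘ var) (sym (toℕ-fromℕ< i<k))) eq
    saturated-covers sat ⊥' = All.lookup sat (∈-++⁺ʳ _ (Any.here refl))
    saturated-covers sat (inv₁ ⇒ inv₂) =
      let i , eq₁ = saturated-covers sat inv₁
          j , eq₂ = saturated-covers sat inv₂
          l , eq  = All.lookup sat (∈-++⁺ʳ _ (Any.there (∈-++⁺ˡ
                      (∈-cartesianProductWith⁺ _⇒ₖ_ (∈-tabulate⁺ i) (∈-tabulate⁺ j)))))
      in l , trans (key-⇒ eq₁ eq₂) eq
    saturated-covers sat (◇ {a} inv) =
      let i , eq₁ = saturated-covers sat inv
          l , eq  = All.lookup sat (∈-++⁺ʳ _ (Any.there (∈-++⁺ʳ _
                      (∈-cartesianProductWith⁺ ◇ₖ (∈-allFin a) (∈-tabulate⁺ i)))))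
      in l , trans (key-◇ eq₁) eq

    finitely-many-classes : ∃ λ s → Σ (Fin s → Fmₖ) λ S →
                            ∀ {φ} → InVars k φ → ∃ λ i → key φ ≡ key (proj₁ (S i))
    finitely-many-classes =
      let s , S , sat = saturate oneStep in s , S , saturated-covers sat

module FiniteModels (m N k : ℕ) where

  Rel : Set
  Rel = Fin m → Fin N → Fin N → Bool

  Val : Set
  Val = Fin N → Fin k → Bool

  truthᶠ : Rel → Val → Fm m → Fin N → Bool
  truthᶠ rel val = Semantics.truth (finiteFrame rel) (finiteValuation rel val)

  pointwise-equal-models : ∀ {rel rel' : Rel} {val val' : Val} →
    (∀ a j j' → rel a j j' ≡ rel' a j j') → (∀ j i → val j i ≡ val' j i) →
    BoundedMorphism k (finiteFrame rel) (finiteFrame rel')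
                      (finiteValuation rel val) (finiteValuation rel' val') id
  pointwise-equal-models {rel} {rel'} {val} {val'} rel≗ val≗ = record
    { forth = λ a {j} {j'} r → trans (sym (rel≗ a j j')) r
    ; back  = λ a {j} {j'} r → j' , trans (rel≗ a j j') r , refl
    ; atoms = λ i j → begin
        proj₁ (finiteValuation rel val (toℕ i)) j   ≡⟨ finiteValuation-toℕ rel val i j ⟩
        val j i                                     ≡⟨ val≗ j i ⟩
        val' j i                                    ≡⟨ finiteValuation-toℕ rel' val' i j ⟨
        proj₁ (finiteValuation rel' val' (toℕ i)) j ∎
    }
    where open ≡-Reasoning

  RelCode : ℕ
  RelCode = ((2 ^ N) ^ N) ^ m

  ValCode : ℕ
  ValCode = (2 ^ k) ^ N

  encodeRel : Rel → Fin RelCode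
  encodeRel rel = funToFin λ a → funToFin λ j → ⌜ rel a j ⌝

  decodeRel : Fin RelCode → Rel
  decodeRel ρ a j = ⌞ finToFun {2 ^ N} {N} (finToFun {(2 ^ N) ^ N} {m} ρ a) j ⌟

  encodeVal : Val → Fin ValCode
  encodeVal val = funToFin λ j → ⌜ val j ⌝

  decodeVal : Fin ValCode → Val
  decodeVal ν j = ⌞ finToFun {2 ^ k} {N} ν j ⌟

  decodeRel-encodeRel : ∀ rel a j j' → decodeRel (encodeRel rel) a j j' ≡ rel a j j'
  decodeRel-encodeRel rel a j j' = begin
    ⌞ finToFun (finToFun (encodeRel rel) a) j ⌟ j'
      ≡⟨ cong (λ c → ⌞ finToFun {2 ^ N} {N} c j ⌟ j') (finToFun-funToFin _ a) ⟩
    ⌞ finToFun (funToFin λ j → ⌜ rel a j ⌝) j ⌟ j'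
      ≡⟨ cong (λ c → ⌞ c ⌟ j') (finToFun-funToFin _ j) ⟩
    ⌞ ⌜ rel a j ⌝ ⌟ j'
      ≡⟨ ⌞⌜⌝⌟ (rel a j) j' ⟩
    rel a j j' ∎
    where open ≡-Reasoning

  decodeVal-encodeVal : ∀ val j i → decodeVal (encodeVal val) j i ≡ val j i
  decodeVal-encodeVal val j i = begin
    ⌞ finToFun (encodeVal val) j ⌟ i ≡⟨ cong (λ c → ⌞ c ⌟ i) (finToFun-funToFin _ j) ⟩
    ⌞ ⌜ val j ⌝ ⌟ i                  ≡⟨ ⌞⌜⌝⌟ (val j) i ⟩
    val j i                          ∎
    where open ≡-Reasoning

  truthᶜ : Fin RelCode → Fin ValCode → Fm m → Fin N → Bool
  truthᶜ ρ ν = truthᶠ (decodeRel ρ) (decodeVal ν)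

  Table : ℕ
  Table = ((2 ^ N) ^ ValCode) ^ RelCode

  -- Opaque so that unification can read φ off table φ.
  opaque
    table : Fm m → Fin Table
    table φ = funToFin λ ρ → funToFin λ ν → ⌜ truthᶜ ρ ν φ ⌝

    table-≡⇔ : ∀ φ ψ → table φ ≡ table ψ ⇔ (∀ ρ ν j → truthᶜ ρ ν φ j ≡ truthᶜ ρ ν ψ j)
    table-≡⇔ φ ψ = mk⇔
      (λ eq ρ ν → ⌜⌝-injective {N} (funToFin-injective (funToFin-injective eq ρ) ν))
      (λ same → funToFin-cong λ ρ → funToFin-cong λ ν → ⌜⌝-cong {N} (same ρ ν))

  table-⇒ : ∀ {φ φ' ψ ψ'} → table φ ≡ table φ' → table ψ ≡ table ψ' →
            table (φ ⇒ ψ) ≡ table (φ' ⇒ ψ')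
  table-⇒ {φ} {φ'} {ψ} {ψ'} eq₁ eq₂ = from (table-≡⇔ (φ ⇒ ψ) (φ' ⇒ ψ')) λ ρ ν j →
    cong₂ (λ a b → not a ∨ b) (to (table-≡⇔ φ φ') eq₁ ρ ν j)
                              (to (table-≡⇔ ψ ψ') eq₂ ρ ν j)

  table-◇ : ∀ {a φ φ'} → table φ ≡ table φ' → table (◇ a φ) ≡ table (◇ a φ')
  table-◇ {a} {φ} {φ'} eq = from (table-≡⇔ (◇ a φ) (◇ a φ')) λ ρ ν →
    Semantics.◇-cong (finiteFrame (decodeRel ρ)) (finiteValuation (decodeRel ρ) (decodeVal ν)) a φ φ'
      (to (table-≡⇔ φ φ') eq ρ ν)

  table-injective : ∀ {φ ψ} → InVars k φ → InVars k ψ → table φ ≡ table ψ →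
                    ∀ rel val j → truthᶠ rel val φ j ≡ truthᶠ rel val ψ j
  table-injective {φ} {ψ} invφ invψ eq rel val j = begin
    truthᶠ rel val φ j   ≡⟨ bounded-morphism-preserves-truth recode invφ j ⟩
    truthᶜ ρ ν φ j       ≡⟨ to (table-≡⇔ φ ψ) eq ρ ν j ⟩
    truthᶜ ρ ν ψ j       ≡⟨ bounded-morphism-preserves-truth recode invψ j ⟨
    truthᶠ rel val ψ j   ∎
    where
    open ≡-Reasoning
    ρ = encodeRel rel
    ν = encodeVal val
    recode = pointwise-equal-models (λ a j j' → sym (decodeRel-encodeRel rel a j j'))
                                    (λ j i → sym (decodeVal-encodeVal val j i))

¬¬-decide : ∀ {n} {P : Fin n → Set} → ¬ ¬ (∀ i → Dec (P i))
¬¬-decide = ¬¬-Π-Fin λ _ → ¬¬-excluded-middle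

Tuned-∘ : ∀ {X : Set} {R : X → X → Set} {n n'} {d : X → Fin n} {g : Fin n → Fin n'} →
          Injective _≡_ _≡_ g → Tuned R d → Tuned R (g ∘ d)
Tuned-∘ {g = g} g-injective tuned a a' b eq r =
  let b' , eq' , r' = tuned a a' b (g-injective eq) r in b' , cong g eq' , r'

Homogeneous : ∀ {m} k (F : GFrame m) → Valuation F → ∀ {N} → (X F → Fin N) → Set
Homogeneous k F v d =
  ∀ {x y} → d x ≡ d y → ∀ (i : Fin k) → proj₁ (v (toℕ i)) x ≡ proj₁ (v (toℕ i)) y

FiniteImage : ∀ {m} k N (F : GFrame m) → Valuation F → Set
FiniteImage k N F v = ∃₂ λ rel (val : Fin N → Fin k → Bool) → ∃ λ h →
  BoundedMorphism k F (finiteFrame rel) v (finiteValuation rel val) h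

module _ {m k N} {F : GFrame m} (v : Valuation F) (d : X F → Fin N)
         (homogeneous : Homogeneous k F v d) (tuned : ∀ a → Tuned (R F a) d) where

  Linked : Fin m → Fin N → Fin N → Set
  Linked a j j' = ∃₂ λ x y → d x ≡ j × d y ≡ j' × R F a x y

  Marked : Fin N → Fin k → Set
  Marked j i = ∃ λ x → d x ≡ j × proj₁ (v (toℕ i)) x ≡ true

  quotient-model : (linked? : ∀ a j j' → Dec (Linked a j j')) (marked? : ∀ j i → Dec (Marked j i)) →
    let rel = λ a j j' → ⌊ linked? a j j' ⌋; val = λ j i → ⌊ marked? j i ⌋
    in BoundedMorphism k F (finiteFrame rel) v (finiteValuation rel val) d
  quotient-model linked? marked? = record
    { forth = λ a {x} {y} r → from (⌊⌋-≡true⇔ (linked? a (d x) (d y))) (x , y , refl , refl , r)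
    ; back  = λ a {x} {u} r →
        let x₀ , y₀ , dx₀≡dx , dy₀≡u , r₀ = to (⌊⌋-≡true⇔ (linked? a (d x) u)) r
            y , dy≡dy₀ , r' = tuned a x₀ x y₀ dx₀≡dx r₀
        in y , r' , trans dy≡dy₀ dy₀≡u
    ; atoms = λ i x → trans (Bool.⇔→≡ (mk⇔
        (λ t → from (⌊⌋-≡true⇔ (marked? (d x) i)) (x , refl , t))
        (λ t → let y , dy≡dx , ty = to (⌊⌋-≡true⇔ (marked? (d x) i)) t
               in trans (sym (homogeneous dy≡dx i)) ty)))
        (sym (finiteValuation-toℕ (λ a j j' → ⌊ linked? a j j' ⌋) (λ j i → ⌊ marked? j i ⌋)
                                  i (d x)))
    }

  ¬¬-quotient-model : ¬ ¬ FiniteImage k N F v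
  ¬¬-quotient-model = do
    linked? ← ¬¬-Π-Fin λ a → ¬¬-Π-Fin λ j → ¬¬-decide
    marked? ← ¬¬-Π-Fin λ j → ¬¬-decide
    pure (_ , _ , d , quotient-model linked? marked?)
    where open RawMonad ¬¬-Monad

-- Uniform tunability implies local tabularity

TunableBy : ∀ {m} → Class m → (ℕ → ℕ) → Set₁
TunableBy {m} 𝓕 f =
  ∀ (F : GFrame m) → 𝓕 F →
  ∀ (n : ℕ) (c : X F → Fin n) → Surjective c → (∀ i → 𝒫 F (Block c i)) →
  Σ ℕ λ n' → n' ≤ f n × Σ (X F → Fin n') λ d →
    Refines d c × (∀ (a : Fin m) → Tuned (R F a) d)

module FromUniformTunability {m} (𝓕 : Class m) (f : ℕ → ℕ) (tunable : TunableBy 𝓕 f) (k : ℕ) where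

  N : ℕ
  N = max 0 (applyUpTo f (suc (2 ^ k)))

  f≤N : ∀ {n} → n ≤ 2 ^ k → f n ≤ N
  f≤N n≤2^k = All.lookup (xs≤max 0 (applyUpTo f (suc (2 ^ k)))) (∈-applyUpTo⁺ f (s≤s n≤2^k))

  open FiniteModels m N k

  module _ {F : GFrame m} (F∈𝓕 : 𝓕 F) (v : Valuation F) where
    open Semantics F v

    variables : Fin k → Fm m
    variables = var ∘ toℕ

    module _ (fac : ImageFactorisation (profile variables)) where
      open ImageFactorisation fac

      tuned-refinement : Σ (X F → Fin N) λ d → Homogeneous k F v d × (∀ a → Tuned (R F a) d)
      tuned-refinement
        with tunable F F∈𝓕 n surjection surjective
                     (Block∈𝒫 {φs = variables} surjective surjection-≡⇔)
      ... | n' , n'≤fn , d , refines , tuned =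
        embed ∘ d ,
        (λ eq → ⌜⌝-injective {k} (to surjection-≡⇔ (refines _ _ (embed-injective eq)))) ,
        (λ a → Tuned-∘ embed-injective (tuned a))
        where
        n'≤N = ≤-trans n'≤fn (f≤N n≤K)
        embed : Fin n' → Fin N
        embed i = inject≤ i n'≤N
        embed-injective : Injective _≡_ _≡_ embed
        embed-injective = inject≤-injective n'≤N n'≤N _ _

    finite-image : ¬ ¬ FiniteImage k N F v
    finite-image = do
      image? ← ¬¬-decide
      let d , homogeneous , tuned = tuned-refinement (image-factorisation (profile variables) image?)
      ¬¬-quotient-model v d homogeneous tuned
      where open RawMonad ¬¬-Monad

  -- Building the quotient model decides finitely many propositions classically; this is harmless
  -- because the conclusion is an equation between booleans, which is stable under double negation.
  table-sound : ∀ {φ ψ} → InVars k φ → InVars k ψ → table φ ≡ table ψ → LogicOf 𝓕 (φ ⇔' ψ)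
  table-sound {φ} {ψ} invφ invψ eq F F∈𝓕 v x =
    from (⇔'-true⇔≡ {φ} {ψ} {x})
      (decidable-stable (truth φ x Bool.≟ truth ψ x) (¬¬-map agree (finite-image F∈𝓕 v)))
    where
    open Semantics F v
    agree : FiniteImage k N F v → truth φ x ≡ truth ψ x
    agree (rel , val , h , hom) = begin
      truth φ x              ≡⟨ bounded-morphism-preserves-truth hom invφ x ⟩
      truthᶠ rel val φ (h x) ≡⟨ table-injective invφ invψ eq rel val (h x) ⟩
      truthᶠ rel val ψ (h x) ≡⟨ bounded-morphism-preserves-truth hom invψ x ⟨
      truth ψ x              ∎
      where open ≡-Reasoning

uniformlyTunable⇒locallyTabular : ∀ {m} (𝓕 : Class m) →
                                  UniformlyTunable 𝓕 → LocallyTabular (LogicOf 𝓕)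
uniformlyTunable⇒locallyTabular {m} 𝓕 (f , tunable) k =
  let _ , S , covered = finitely-many-classes table table-⇒ table-◇
  in tabulate (proj₁ ∘ S) , All.tabulate⁺ (proj₂ ∘ S) , λ φ invφ →
       let i , eq = covered invφ in Any.tabulate⁺ i (table-sound invφ (proj₂ (S i)) eq)
  where
  open FromUniformTunability 𝓕 f tunable k
  open FiniteModels m N k using (table; table-⇒; table-◇)
  open Generation m k using (finitely-many-classes)

corollary4p14 : ∀ (m : ℕ) (𝓕 : Class m) →
    (LocallyTabular (LogicOf 𝓕) → UniformlyTunable 𝓕) × (UniformlyTunable 𝓕 → LocallyTabular (LogicOf 𝓕))
corollary4p14 m 𝓕 = locallyTabular⇒uniformlyTunable 𝓕 , uniformlyTunable⇒locallyTabular 𝓕
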